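{- Let $\mathcal{C}$ be a category, $\mathcal{M}:\mathcal{C}\to\mathbf{Mod}_\mathcal{T}^{\mathsf{op}}$ a first-order model internal to $\mathbf{Psh}(\mathcal{C})$, and $\mathcal{M}^\bullet:\mathcal{C}\to\mathbf{DispMod}_\mathcal{T}^{\mathsf{op}}$ a displayed first-order model over it. If $\mathcal{C}$ has a terminal object $1_\mathcal{C}$ and $\mathcal{M}(1_\mathcal{C})$ is the initial first-order model of $\mathcal{T}$, then the category of sections $\mathbf{Sect}_\mathcal{T}^{\mathsf{op}}[\mathcal{M}^\bullet]$ has a terminal object that is strictly preserved by $\pi_0$.
   Context: $\mathcal{T}$ is a dependent type theory with $\Pi$-types; $\mathbf{Mod}_\mathcal{T}$ is the category of first-order models (CwFs with $\Pi$-types). $\mathbf{DispMod}_\mathcal{T}$ is the category of pairs of a first-order model and a displayed first-order model over it, with forgetful functor $U$ to $\mathbf{Mod}_\mathcal{T}$; $\mathcal{M}^\bullet$ satisfies $U\circ\mathcal{M}^\bullet=\mathcal{M}$, so for each $\Gamma$, $\mathcal{M}^\bullet(\Gamma)$ is a displayed model over $\mathcal{M}(\Gamma)$, and for $f:\Gamma\to\Delta$ in $\mathcal{C}$ there are morphisms $\mathcal{M}(f):\mathcal{M}(\Delta)\to\mathcal{M}(\Gamma)$ and $\mathcal{M}^\bullet(f)$ over it. The category $\mathbf{Sect}_\mathcal{T}^{\mathsf{op}}[\mathcal{M}^\bullet]$ is the pullback of $\mathcal{M}^\bullet$ along the forgetful functor $\mathbf{Sect}_\mathcal{T}^{\mathsf{op}}\to\mathbf{DispMod}_\mathcal{T}^{\mathsf{op}}$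 (where $\mathbf{Sect}_\mathcal{T}$ is the category of displayed models equipped with a section); explicitly, objects are pairs $(\Gamma,[\![-]\!]_\Gamma)$ with $\Gamma\in\mathcal{C}$ and $[\![-]\!]_\Gamma$ a section of $\mathcal{M}^\bullet(\Gamma)$ over $\mathcal{M}(\Gamma)$ (a morphism of models $\mathcal{M}(\Gamma)\to$ total model of $\mathcal{M}^\bullet(\Gamma)$ splitting the projection), and morphisms $(\Gamma,[\![-]\!]_\Gamma)\to(\Delta,[\![-]\!]_\Delta)$ are $f:\Gamma\to\Delta$ in $\mathcal{C}$ with $\mathcal{M}^\bullet(f)\circ[\![-]\!]_\Delta=[\![-]\!]_\Gamma\circ\mathcal{M}(f)$. $\pi_0$ is the projection $(\Gamma,[\![-]\!]_\Gamma)\mapsto\Gamma$. -}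

module Defs where

open import Level using (Level; _⊔_; suc)
open import Relation.Binary.PropositionalEquality using (_≡_; sym)
open import Data.Product using (Σ; _×_)

record Category (o ℓ : Level) : Set (suc (o ⊔ ℓ)) where
  infixr 9 _∘_
  field
    Obj : Set o
    Hom : Obj → Obj → Set ℓ
    id  : ∀ {A} → Hom A A
    _∘_ : ∀ {A B C} → Hom B C → Hom A B → Hom A C
    identityˡ : ∀ {A B} (f : Hom A B) → id ∘ f ≡ f
    identityʳ : ∀ {A B} (f : Hom A B) → f ∘ id ≡ f
    assoc : ∀ {A B C D} (f : Hom A B) (g : Hom B C) (h : Hom C D) →
            (h ∘ g) ∘ f ≡ h ∘ (g ∘ f)

op : ∀ {o ℓ} → Category o ℓ → Category o ℓ
op C = record
  { Obj = Obj
  ; Hom = λ A B → Hom B A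
  ; id = id
  ; _∘_ = λ g f → f ∘ g
  ; identityˡ = identityʳ
  ; identityʳ = identityˡ
  ; assoc = λ f g h → sym (assoc h g f)
  }
  where open Category C

record Functor {o ℓ o' ℓ'} (C : Category o ℓ) (D : Category o' ℓ')
       : Set (o ⊔ ℓ ⊔ o' ⊔ ℓ') where
  private
    module C = Category C
    module D = Category D
  field
    F₀ : C.Obj → D.Obj
    F₁ : ∀ {A B} → C.Hom A B → D.Hom (F₀ A) (F₀ B)
    identity : ∀ {A} → F₁ (C.id {A}) ≡ D.id
    homomorphism : ∀ {A B C'} (f : C.Hom A B) (g : C.Hom B C') →
                   F₁ (g C.∘ f) ≡ F₁ g D.∘ F₁ f

record Terminal {o ℓ} (C : Category o ℓ) : Set (o ⊔ ℓ) where
  open Category C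
  field
    ⊤ : Obj
    ! : ∀ {A} → Hom A ⊤
    !-unique : ∀ {A} (f : Hom A ⊤) → f ≡ !

IsInitial : ∀ {o ℓ} (C : Category o ℓ) → Category.Obj C → Set (o ⊔ ℓ)
IsInitial C X = ∀ Y → Σ (Hom X Y) (λ h → ∀ (g : Hom X Y) → g ≡ h)
  where open Category C

-- The relevant structure of the theory T:
--   * Mod     : category of first-order models of T (CwFs with Π-types)
--   * DispMod : category of pairs (model, displayed model over it)
--   * U       : forgetful functor DispMod → Mod
--   * Tot     : total-model functor DispMod → Mod
--   * proj    : the projections  Tot X → U X  (natural in X)
record ModelTheory (o ℓ : Level) : Set (suc (o ⊔ ℓ)) where
  field
    Mod     : Category o ℓ
    DispMod : Category o ℓ
    U       : Functor DispMod Mod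
    Tot     : Functor DispMod Mod
  open Category Mod
  private
    module DM = Category DispMod
    module U = Functor U
    module Tot = Functor Tot
  field
    proj    : ∀ X → Hom (Tot.F₀ X) (U.F₀ X)
    proj-natural : ∀ {X Y} (f : DM.Hom X Y) →
                   proj Y ∘ Tot.F₁ f ≡ U.F₁ f ∘ proj X

  record Section (X : DM.Obj) : Set ℓ where
    field
      sec   : Hom (U.F₀ X) (Tot.F₀ X)
      split : proj X ∘ sec ≡ id

module SectCat {o ℓ o' ℓ'} (Th : ModelTheory o ℓ) (C : Category o' ℓ')
  (M• : Functor (op C) (ModelTheory.DispMod Th)) where
  open ModelTheory Th
  private
    module C = Category C
    module Mod = Category Mod
    module M• = Functor M•
    module U = Functor U
    module Tot = Functor Tot

  -- The base model M = U ∘ M• (so U ∘ M• = M holds by definition).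
  M₀ : C.Obj → Mod.Obj
  M₀ Γ = U.F₀ (M•.F₀ Γ)

  record SectObj : Set (o' ⊔ ℓ) where
    constructor _,_
    field
      ctx : C.Obj
      ⟦⟧  : Section (M•.F₀ ctx)

  π₀ : SectObj → C.Obj
  π₀ = SectObj.ctx

  record SectHom (X Y : SectObj) : Set (ℓ ⊔ ℓ') where
    private
      module X = SectObj X
      module Y = SectObj Y
    field
      hom  : C.Hom X.ctx Y.ctx
      comm : Tot.F₁ (M•.F₁ hom) Mod.∘ Section.sec Y.⟦⟧
             ≡ Section.sec X.⟦⟧ Mod.∘ U.F₁ (M•.F₁ hom)

  -- Terminal object of Sect^op_T[M•] (morphisms are determined by their
  -- underlying C-morphism, the commutation condition being a property).
  IsTerminalSect : SectObj → Set (o' ⊔ ℓ ⊔ ℓ')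
  IsTerminalSect T = ∀ (X : SectObj) →
    Σ (SectHom X T) (λ h → ∀ (g : SectHom X T) → SectHom.hom g ≡ SectHom.hom h)

{-# OPTIONS --safe #-}
-- Every model morphism out of the initial model M(1) is unique, so M•(1) has a
-- (unique) section, and the commutation condition of a morphism of sections
-- into (1 , ⟦-⟧) — an equation between two model morphisms out of M(1) —
-- holds automatically. Morphisms into it are therefore just the morphisms
-- into 1 in C, of which there is exactly one.
module Submission where

open import Defs
open import Level using (Level)
open import Relation.Binary.PropositionalEquality using (_≡_; refl; trans; sym)
open import Data.Product using (Σ; _×_; _,_; proj₁; proj₂)

IsInitial-hom-unique : ∀ {o ℓ} (C : Category o ℓ) {X : Category.Obj C} →
  IsInitial C X → ∀ {Y} (f g : Category.Hom C X Y) → f ≡ g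
IsInitial-hom-unique C init {Y} f g =
  trans (proj₂ (init Y) f) (sym (proj₂ (init Y) g))

module _ {o ℓ o' ℓ'} (Th : ModelTheory o ℓ) (C : Category o' ℓ')
         (M• : Functor (op C) (ModelTheory.DispMod Th)) where
  open ModelTheory Th
  open SectCat Th C M•
  private
    module C = Category C
    module M• = Functor M•

  initialSection : ∀ {Γ} → IsInitial Mod (M₀ Γ) → Section (M•.F₀ Γ)
  initialSection init = record
    { sec   = proj₁ (init _)
    ; split = IsInitial-hom-unique Mod init _ _
    }

  sectHom-into-initial : ∀ {X Y} → IsInitial Mod (M₀ (SectObj.ctx Y)) →
    C.Hom (SectObj.ctx X) (SectObj.ctx Y) → SectHom X Y
  sectHom-into-initial init f = record
    { hom  = f
    ; comm = IsInitial-hom-unique Mod init _ _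
    }

  initialSection-isTerminalSect : (1C : Terminal C)
    (init : IsInitial Mod (M₀ (Terminal.⊤ 1C))) →
    IsTerminalSect (Terminal.⊤ 1C , initialSection init)
  initialSection-isTerminalSect 1C init X =
    sectHom-into-initial init ! , λ g → !-unique (SectHom.hom g)
    where open Terminal 1C

mainTheorem8 : {o ℓ o' ℓ' : Level} (Th : ModelTheory o ℓ) (C : Category o' ℓ')
    (M• : Functor (op C) (ModelTheory.DispMod Th)) (1C : Terminal C) →
    IsInitial (ModelTheory.Mod Th) (SectCat.M₀ Th C M• (Terminal.⊤ 1C)) →
    Σ (SectCat.SectObj Th C M•) (λ T →
      SectCat.IsTerminalSect Th C M• T × SectCat.π₀ Th C M• T ≡ Terminal.⊤ 1C)
mainTheorem8 Th C M• 1C init =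
  (Terminal.⊤ 1C SectCat., initialSection Th C M• init) ,
  initialSection-isTerminalSect Th C M• 1C init ,
  refl
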